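{- For every integer $n\ge 0$, \[ \overline{p}_o(n)=\sum_{k=0}^{\infty}\mathrm{pod}(n-\tfrac{k(k+1)}{2}). \]
   Context: $\overline{p}_o(n)$ denotes the number of overpartitions of $n$ into odd parts (partitions into odd parts in which the first occurrence of each part size may be overlined); $\sum_{n\ge0}\overline{p}_o(n)q^n=\frac{(-q;q^2)_\infty}{(q;q^2)_\infty}$, where $(a;q)_\infty=\prod_{k\ge1}(1-aq^{k-1})$. $\mathrm{pod}(n)$ denotes the number of partitions of $n$ in which odd parts are distinct and even parts are unrestricted; $\sum_{n\ge0}\mathrm{pod}(n)q^n=\frac{(-q;q^2)_\infty}{(q^2;q^2)_\infty}$. Convention: these functions vanish at arguments that are not nonnegative integers. -}

module Defs where

open import Data.Nat using (ℕ; zero; suc; _+_; _*_; _∸_; _≤ᵇ_)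
open import Data.Nat.Properties using ()
open import Data.Bool using (Bool; true; false; if_then_else_)
open import Data.List using (List; map; upTo)
open import Data.Nat.ListAction using (sum)

δ₀ : ℕ → ℕ
δ₀ zero    = 1
δ₀ (suc _) = 0

isOdd : ℕ → Bool
isOdd zero          = false
isOdd (suc zero)    = true
isOdd (suc (suc n)) = isOdd n

shiftAt : (ℕ → ℕ) → ℕ → ℕ → ℕ
shiftAt f n t = if t ≤ᵇ n then f (n ∸ t) else 0

-- Σ_{m ≥ 1} f (n - m*s)   (terms with m*s > n vanish; for s ≥ 1 it suffices
-- to take m ≤ n)
sumMult≥1 : ℕ → ℕ → (ℕ → ℕ) → ℕ
sumMult≥1 s n f = sum (map (λ m → shiftAt f n (suc m * s)) (upTo n))

-- Overpartitions into odd parts, counted by multiplicities.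
-- ovOdd k n = number of overpartitions of n into odd parts all lying in
-- {1, 3, …, 2k-1}.  Adding the part size s = 2k+1 with multiplicity m:
-- m = 0 contributes ovOdd k n; each m ≥ 1 contributes 2 · ovOdd k (n - m s)
-- (first occurrence overlined or not).
ovOdd : ℕ → ℕ → ℕ
ovOdd zero    n = δ₀ n
ovOdd (suc k) n = ovOdd k n + 2 * sumMult≥1 (suc (2 * k)) n (ovOdd k)

-- p̄ₒ(n): all odd parts ≤ 2n-1 (which covers every odd part ≤ n)
pbarO : ℕ → ℕ
pbarO n = ovOdd n n

-- Partitions with distinct odd parts and unrestricted even parts.
-- podB k n = number of such partitions of n with all parts in {1, …, k}.
-- Part size s = k+1: if s is odd, multiplicity 0 or 1; if even, any m ≥ 0.
podB : ℕ → ℕ → ℕ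
podB zero    n = δ₀ n
podB (suc k) n with isOdd (suc k)
... | true  = podB k n + shiftAt (podB k) n (suc k)
... | false = podB k n + sumMult≥1 (suc k) n (podB k)

pod : ℕ → ℕ
pod n = podB n n

tri : ℕ → ℕ
tri zero    = 0
tri (suc k) = tri k + suc k

-- Σ_{k=0}^{∞} pod (n - k(k+1)/2); terms with k > n vanish since tri k ≥ k > n
podTriSum : ℕ → ℕ
podTriSum n = sum (map (λ k → shiftAt pod n (tri k)) (upTo (suc n)))

{-# OPTIONS --safe #-}
-- Power series over ℕ are coefficient sequences, and the products involved act on them as operators:
-- division by 1 - q^s (geom), multiplication by 1 + q^s (onePlus) and by Σ_k q^{k(k+1)/2} (theta).
-- These multipliers are causal, additive and commute with shifts, and since geom f is the unique
-- solution of h = f + q^s h, any multiplier commutes with geom; this replaces commutativity of products.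
--
-- As p̄ₒ and pod have generating functions (-q;q²)_∞ / (q;q²)_∞ and (-q;q²)_∞ / (q²;q²)_∞, the theorem
-- is Gauss's identity Σ_k q^{k(k+1)/2} = (q²;q²)_∞ / (q;q²)_∞ multiplied by the latter series. It
-- holds modulo q^{N+1} for each N: at z = 1 the finite Jacobi triple product tends to
-- (-q;q)_∞² = Σ_k q^{k(k+1)/2} / (q;q)_∞, because its Gaussian binomials tend to 1 / (q;q)_∞. Euler's
-- (-q;q)_∞ = 1 / (q;q²)_∞ and (q;q)_∞ = (q;q²)_∞ (q²;q²)_∞ turn this into
-- 1 / (q;q²)_∞² = Σ_k q^{k(k+1)/2} / ((q;q²)_∞ (q²;q²)_∞), and one factor 1 / (q;q²)_∞ cancels.
module Submission where

open import Defs
open import Data.Nat using (ℕ; zero; suc; _+_; _*_; _∸_; _≤_; _<_; _≤ᵇ_; z≤n; s≤s; _≤?_)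
open import Data.Nat.Properties
open import Data.Bool using (true; false)
open import Data.List using (applyUpTo)
open import Data.List.Properties using (map-upTo)
open import Data.Nat.ListAction using (sum)
open import Data.Sum using (inj₁; inj₂)
open import Function using (id; _∘_)
open import Relation.Nullary using (yes; no; contradiction)
open import Relation.Nullary.Reflects using (ofʸ; ofⁿ)
open import Relation.Binary.PropositionalEquality
open import Data.Nat.Tactic.RingSolver using (solve-∀)
open import Relation.Binary.Bundles using (Setoid)
import Relation.Binary.Reasoning.Setoid as SetoidReasoning
open import Algebra.Properties.CommutativeSemigroup +-commutativeSemigroup
  using (interchange; xy∙z≈x∙zy; xy∙z≈xz∙y)

-- Power series, shifts and finite sums

Series : Set
Series = ℕ → ℕ

Op : Set
Op = Series → Series

module ≗-Reasoning = SetoidReasoning (ℕ →-setoid ℕ)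
open Setoid (ℕ →-setoid ℕ) using () renaming (refl to ≗-refl; sym to ≗-sym; trans to ≗-trans)

infixl 6 _⊕_
infixr 7 q^_·_
infix 4 _≗[_]_

_⊕_ : Series → Series → Series
(f ⊕ g) n = f n + g n

q^_·_ : ℕ → Series → Series
(q^ e · f) n = shiftAt f n e

_≗[_]_ : Series → ℕ → Series → Set
f ≗[ n ] g = ∀ m → m ≤ n → f m ≡ g m

≗⇒≗[] : ∀ {f g n} → f ≗ g → f ≗[ n ] g
≗⇒≗[] f≗g m _ = f≗g m

≗[]-restrict : ∀ {f g k n} → k ≤ n → f ≗[ n ] g → f ≗[ k ] g
≗[]-restrict k≤n f≗g m m≤k = f≗g m (≤-trans m≤k k≤n)

≗[]-sym : ∀ {f g n} → f ≗[ n ] g → g ≗[ n ] f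
≗[]-sym f≗g m m≤n = sym (f≗g m m≤n)

infixr 5 _⟨≗[]⟩_
_⟨≗[]⟩_ : ∀ {f g h n} → f ≗[ n ] g → g ≗[ n ] h → f ≗[ n ] h
(f≗g ⟨≗[]⟩ g≗h) m m≤n = trans (f≗g m m≤n) (g≗h m m≤n)

≗[]-setoid : ℕ → Setoid _ _
≗[]-setoid n = record
  { Carrier       = Series
  ; _≈_           = _≗[ n ]_
  ; isEquivalence = record { refl = λ _ _ → refl ; sym = ≗[]-sym ; trans = _⟨≗[]⟩_ }
  }

module ≗[]-Reasoning n = SetoidReasoning (≗[]-setoid n)

⊕-cong : ∀ {f f′ g g′} → f ≗ f′ → g ≗ g′ → f ⊕ g ≗ f′ ⊕ g′
⊕-cong f≗f′ g≗g′ m = cong₂ _+_ (f≗f′ m) (g≗g′ m)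

⊕-congˡ : ∀ {f g g′} → g ≗ g′ → f ⊕ g ≗ f ⊕ g′
⊕-congˡ = ⊕-cong ≗-refl

⊕-congʳ : ∀ {f f′ g} → f ≗ f′ → f ⊕ g ≗ f′ ⊕ g
⊕-congʳ f≗f′ = ⊕-cong f≗f′ ≗-refl

⊕-assoc : ∀ f g h → (f ⊕ g) ⊕ h ≗ f ⊕ (g ⊕ h)
⊕-assoc f g h m = +-assoc (f m) (g m) (h m)

⊕-comm : ∀ f g → f ⊕ g ≗ g ⊕ f
⊕-comm f g m = +-comm (f m) (g m)

⊕-interchange : ∀ f g h k → (f ⊕ g) ⊕ (h ⊕ k) ≗ (f ⊕ h) ⊕ (g ⊕ k)
⊕-interchange f g h k m = interchange (f m) (g m) (h m) (k m)

⊕-swapʳ : ∀ f g h → (f ⊕ g) ⊕ h ≗ (f ⊕ h) ⊕ g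
⊕-swapʳ f g h m = xy∙z≈xz∙y (f m) (g m) (h m)

⊕-swap-inner : ∀ f g h → (f ⊕ g) ⊕ h ≗ f ⊕ (h ⊕ g)
⊕-swap-inner f g h m = xy∙z≈x∙zy (f m) (g m) (h m)

data Split (t : ℕ) : ℕ → Set where
  below : ∀ {m} → m < t → Split t m
  above : ∀ r → Split t (t + r)

split : ∀ t m → Split t m
split t m with t ≤? m
... | no t≰m  = below (≰⇒> t≰m)
... | yes t≤m = subst (Split t) (m+[n∸m]≡n t≤m) (above (m ∸ t))

shift-below : ∀ f {t m} → m < t → (q^ t · f) m ≡ 0
shift-below f {t} {m} m<t with t ≤ᵇ m | ≤ᵇ-reflects-≤ t m
... | false | _        = refl
... | true  | ofʸ t≤m = contradiction t≤m (<⇒≱ m<t)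

shift-above : ∀ f t r → (q^ t · f) (t + r) ≡ f r
shift-above f t r with t ≤ᵇ t + r | ≤ᵇ-reflects-≤ t (t + r)
... | true  | _        = cong f (m+n∸m≡n t r)
... | false | ofⁿ t≰t+r = contradiction (m≤m+n t r) t≰t+r

shift-cong : ∀ t {f g} → f ≗ g → q^ t · f ≗ q^ t · g
shift-cong t {f} {g} f≗g m with split t m
... | below m<t = trans (shift-below f m<t) (sym (shift-below g m<t))
... | above r   = trans (shift-above f t r) (trans (f≗g r) (sym (shift-above g t r)))

shift-causal : ∀ t {f g n} → f ≗[ n ] g → q^ t · f ≗[ t + n ] q^ t · g
shift-causal t {f} {g} f≗g m m≤t+n with split t m
... | below m<t = trans (shift-below f m<t) (sym (shift-below g m<t))
... | above r   = trans (shift-above f t r) (trans (f≗g r (+-cancelˡ-≤ t r _ m≤t+n)) (sym (shift-above g t r)))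

shift-⊕ : ∀ e f g → q^ e · (f ⊕ g) ≗ q^ e · f ⊕ q^ e · g
shift-⊕ e f g m with e ≤ᵇ m
... | true  = refl
... | false = refl

shift-+ : ∀ f b t r → (q^ b + t · f) (b + r) ≡ (q^ t · f) r
shift-+ f b t r with split t r
... | below r<t = trans (shift-below f (+-monoʳ-< b r<t)) (sym (shift-below f r<t))
... | above s   = begin
  (q^ b + t · f) (b + (t + s)) ≡⟨ cong (q^ b + t · f) (+-assoc b t s) ⟨
  (q^ b + t · f) (b + t + s)   ≡⟨ shift-above f (b + t) s ⟩
  f s                          ≡⟨ shift-above f t s ⟨
  (q^ t · f) (t + s)           ∎
  where open ≡-Reasoning

shift-shift : ∀ a b f → q^ a · q^ b · f ≗ q^ a + b · f
shift-shift a b f m with split a m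
... | below m<a = trans (shift-below (q^ b · f) m<a) (sym (shift-below f (<-≤-trans m<a (m≤m+n a b))))
... | above r   = trans (shift-above (q^ b · f) a r) (sym (shift-+ f a b r))

shift-swap : ∀ a b f → q^ a · q^ b · f ≗ q^ b · q^ a · f
shift-swap a b f m = begin
  (q^ a · q^ b · f) m ≡⟨ shift-shift a b f m ⟩
  (q^ a + b · f) m    ≡⟨ cong (λ e → (q^ e · f) m) (+-comm a b) ⟩
  (q^ b + a · f) m    ≡⟨ shift-shift b a f m ⟨
  (q^ b · q^ a · f) m ∎
  where open ≡-Reasoning

shift-distrib : ∀ a b f g → q^ a · (f ⊕ q^ b · g) ≗ q^ a · f ⊕ q^ a + b · g
shift-distrib a b f g = ≗-trans (shift-⊕ a f (q^ b · g)) (⊕-congˡ (shift-shift a b g))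

∑ : ℕ → (ℕ → ℕ) → ℕ
∑ n F = sum (applyUpTo F n)

syntax ∑ n (λ j → F) = ∑[ j < n ] F

∑-cong : ∀ n {F G : ℕ → ℕ} → (∀ j → F j ≡ G j) → ∑ n F ≡ ∑ n G
∑-cong zero    F≡G = refl
∑-cong (suc n) F≡G = cong₂ _+_ (F≡G 0) (∑-cong n (F≡G ∘ suc))

∑-+ : ∀ n (F G : ℕ → ℕ) → ∑[ j < n ] (F j + G j) ≡ ∑ n F + ∑ n G
∑-+ zero    F G = refl
∑-+ (suc n) F G = trans (cong (F 0 + G 0 +_) (∑-+ n (F ∘ suc) (G ∘ suc)))
                        (interchange (F 0) (G 0) (∑ n (F ∘ suc)) (∑ n (G ∘ suc)))

∑-zeros : ∀ n {F : ℕ → ℕ} → (∀ j → F j ≡ 0) → ∑ n F ≡ 0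
∑-zeros zero    F≡0 = refl
∑-zeros (suc n) F≡0 = cong₂ _+_ (F≡0 0) (∑-zeros n (F≡0 ∘ suc))

∑-trunc : ∀ {r n} F → r ≤ n → (∀ j → r ≤ j → F j ≡ 0) → ∑ n F ≡ ∑ r F
∑-trunc {n = n} F z≤n       vanish = ∑-zeros n (λ j → vanish j z≤n)
∑-trunc         F (s≤s r≤n) vanish =
  cong (F 0 +_) (∑-trunc (F ∘ suc) r≤n (λ j r≤j → vanish (suc j) (s≤s r≤j)))

-- f / (1 - q^s) for s ≥ 1 only: sumMult≥1 s n keeps just the multiples s, 2s, …, ns of s.
geom : ℕ → Op
geom s f n = f n + sumMult≥1 s n f

sumMult≥1-∑ : ∀ s n f → sumMult≥1 s n f ≡ ∑[ i < n ] (q^ suc i * s · f) n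
sumMult≥1-∑ s n f = cong sum (map-upTo _ n)

sumMult≥1-rec : ∀ s f n → sumMult≥1 (suc s) n f ≡ (q^ suc s · geom (suc s) f) n
sumMult≥1-rec s f n with split (suc s) n
... | below n<1+s = begin
  sumMult≥1 (suc s) n f               ≡⟨ sumMult≥1-∑ (suc s) n f ⟩
  ∑[ i < n ] (q^ suc i * suc s · f) n ≡⟨ ∑-zeros n (λ i → shift-below f (<-≤-trans n<1+s (m≤m+n (suc s) _))) ⟩
  0                                   ≡⟨ shift-below (geom (suc s) f) n<1+s ⟨
  (q^ suc s · geom (suc s) f) n       ∎
  where open ≡-Reasoning
... | above r = begin
  sumMult≥1 (suc s) (suc s + r) f
    ≡⟨ sumMult≥1-∑ (suc s) (suc s + r) f ⟩
  (q^ suc s + 0 · f) (suc s + r) + ∑[ i < s + r ] (q^ suc s + suc i * suc s · f) (suc s + r)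
    ≡⟨ cong₂ _+_ (shift-+ f (suc s) 0 r) (∑-cong (s + r) (λ i → shift-+ f (suc s) (suc i * suc s) r)) ⟩
  f r + ∑[ i < s + r ] (q^ suc i * suc s · f) r
    ≡⟨ cong (f r +_) (∑-trunc _ (m≤n+m r s) vanish) ⟩
  f r + ∑[ i < r ] (q^ suc i * suc s · f) r
    ≡⟨ cong (f r +_) (sumMult≥1-∑ (suc s) r f) ⟨
  geom (suc s) f r
    ≡⟨ shift-above (geom (suc s) f) (suc s) r ⟨
  (q^ suc s · geom (suc s) f) (suc s + r) ∎
  where
  open ≡-Reasoning
  vanish : ∀ i → r ≤ i → (q^ suc i * suc s · f) r ≡ 0
  vanish i r≤i = shift-below f (≤-trans (s≤s r≤i) (m≤m*n (suc i) (suc s)))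

geom-rec : ∀ s f → geom (suc s) f ≗ f ⊕ q^ suc s · geom (suc s) f
geom-rec s f n = cong (f n +_) (sumMult≥1-rec s f n)

fixpoint-unique : ∀ s {h₁ h₂ f₁ f₂} → h₁ ≗ f₁ ⊕ q^ suc s · h₁ → h₂ ≗ f₂ ⊕ q^ suc s · h₂ →
                  ∀ {n} → f₁ ≗[ n ] f₂ → h₁ ≗[ n ] h₂
fixpoint-unique s {h₁} {h₂} {f₁} {f₂} h₁-rec h₂-rec {n} f₁≗f₂ m m≤n =
  trans (h₁-rec m) (trans (cong₂ _+_ (f₁≗f₂ m m≤n) (tails n f₁≗f₂ m m≤n)) (sym (h₂-rec m)))
  where
  tails : ∀ n → f₁ ≗[ n ] f₂ → q^ suc s · h₁ ≗[ n ] q^ suc s · h₂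
  tails zero    _     zero z≤n =
    trans (shift-below h₁ (s≤s (z≤n {s}))) (sym (shift-below h₂ (s≤s (z≤n {s}))))
  tails (suc n) f₁≗f₂ = ≗[]-restrict (s≤s (m≤n+m n s))
    (shift-causal (suc s) (fixpoint-unique s h₁-rec h₂-rec (≗[]-restrict (n≤1+n n) f₁≗f₂)))

geom-unique : ∀ s {h f} → h ≗ f ⊕ q^ suc s · h → h ≗ geom (suc s) f
geom-unique s h-rec m = fixpoint-unique s h-rec (geom-rec s _) (λ _ _ → refl) m ≤-refl

geom-trunc : ∀ s f → geom (suc s) f ≗[ s ] f
geom-trunc s f m m≤s =
  trans (geom-rec s f m) (trans (cong (f m +_) (shift-below (geom (suc s) f) (s≤s m≤s))) (+-identityʳ (f m)))

geom-cancel : ∀ s {n f g} → geom (suc s) f ≗[ n ] geom (suc s) g → f ≗[ n ] g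
geom-cancel s {n} {f} {g} Gf≗Gg m m≤n = +-cancelʳ-≡ _ (f m) (g m) (begin
  f m + (q^ suc s · geom (suc s) f) m ≡⟨ geom-rec s f m ⟨
  geom (suc s) f m                    ≡⟨ Gf≗Gg m m≤n ⟩
  geom (suc s) g m                    ≡⟨ geom-rec s g m ⟩
  g m + (q^ suc s · geom (suc s) g) m ≡⟨ cong (g m +_) (shift-causal (suc s) Gf≗Gg m (m≤n⇒m≤o+n (suc s) m≤n)) ⟨
  g m + (q^ suc s · geom (suc s) f) m ∎)
  where open ≡-Reasoning

onePlus : ℕ → Op
onePlus s f = f ⊕ q^ s · f

onePlus-trunc : ∀ s f → onePlus (suc s) f ≗[ s ] f
onePlus-trunc s f m m≤s = trans (cong (f m +_) (shift-below f (s≤s m≤s))) (+-identityʳ (f m))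

record Multiplier (L : Op) : Set where
  field
    causal     : ∀ {n f g} → f ≗[ n ] g → L f ≗[ n ] L g
    additive   : ∀ f g → L (f ⊕ g) ≗ L f ⊕ L g
    shift-comm : ∀ e f → L (q^ e · f) ≗ q^ e · L f

  cong≗ : ∀ {f g} → f ≗ g → L f ≗ L g
  cong≗ f≗g m = causal (≗⇒≗[] f≗g) m ≤-refl

open Multiplier

geom-multiplier : ∀ s → Multiplier (geom (suc s))
causal (geom-multiplier s) = fixpoint-unique s (geom-rec s _) (geom-rec s _)
additive (geom-multiplier s) f g = ≗-sym (geom-unique s (begin
  geom (suc s) f ⊕ geom (suc s) g
    ≈⟨ ⊕-cong (geom-rec s f) (geom-rec s g) ⟩
  (f ⊕ q^ suc s · geom (suc s) f) ⊕ (g ⊕ q^ suc s · geom (suc s) g)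
    ≈⟨ ⊕-interchange f (q^ suc s · geom (suc s) f) g (q^ suc s · geom (suc s) g) ⟩
  (f ⊕ g) ⊕ (q^ suc s · geom (suc s) f ⊕ q^ suc s · geom (suc s) g)
    ≈⟨ ⊕-congˡ (shift-⊕ (suc s) (geom (suc s) f) (geom (suc s) g)) ⟨
  (f ⊕ g) ⊕ q^ suc s · (geom (suc s) f ⊕ geom (suc s) g) ∎))
  where open ≗-Reasoning
shift-comm (geom-multiplier s) e f = ≗-sym (geom-unique s (begin
  q^ e · geom (suc s) f                          ≈⟨ shift-cong e (geom-rec s f) ⟩
  q^ e · (f ⊕ q^ suc s · geom (suc s) f)         ≈⟨ shift-⊕ e f (q^ suc s · geom (suc s) f) ⟩
  q^ e · f ⊕ q^ e · q^ suc s · geom (suc s) f    ≈⟨ ⊕-congˡ (shift-swap e (suc s) (geom (suc s) f)) ⟩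
  q^ e · f ⊕ q^ suc s · q^ e · geom (suc s) f    ∎))
  where open ≗-Reasoning

onePlus-multiplier : ∀ s → Multiplier (onePlus s)
causal (onePlus-multiplier s) {n} f≗g m m≤n =
  cong₂ _+_ (f≗g m m≤n) (shift-causal s f≗g m (m≤n⇒m≤o+n s m≤n))
additive (onePlus-multiplier s) f g = begin
  (f ⊕ g) ⊕ q^ s · (f ⊕ g)     ≈⟨ ⊕-congˡ (shift-⊕ s f g) ⟩
  (f ⊕ g) ⊕ (q^ s · f ⊕ q^ s · g) ≈⟨ ⊕-interchange f g (q^ s · f) (q^ s · g) ⟩
  (f ⊕ q^ s · f) ⊕ (g ⊕ q^ s · g) ∎
  where open ≗-Reasoning
shift-comm (onePlus-multiplier s) e f = begin
  q^ e · f ⊕ q^ s · q^ e · f   ≈⟨ ⊕-congˡ (shift-swap s e f) ⟩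
  q^ e · f ⊕ q^ e · q^ s · f   ≈⟨ shift-⊕ e f (q^ s · f) ⟨
  q^ e · (f ⊕ q^ s · f)        ∎
  where open ≗-Reasoning

-- geom is the unique solution of h = f + q^s h, and a multiplier preserves that equation.
geom-comm : ∀ {L} → Multiplier L → ∀ s f → L (geom (suc s) f) ≗ geom (suc s) (L f)
geom-comm {L} mL s f = geom-unique s (begin
  L (geom (suc s) f)                      ≈⟨ cong≗ mL (geom-rec s f) ⟩
  L (f ⊕ q^ suc s · geom (suc s) f)       ≈⟨ additive mL f (q^ suc s · geom (suc s) f) ⟩
  L f ⊕ L (q^ suc s · geom (suc s) f)     ≈⟨ ⊕-congˡ (shift-comm mL (suc s) (geom (suc s) f)) ⟩
  L f ⊕ q^ suc s · L (geom (suc s) f)     ∎)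
  where open ≗-Reasoning

onePlus-comm : ∀ {L} → Multiplier L → ∀ s f → L (onePlus s f) ≗ onePlus s (L f)
onePlus-comm mL s f = ≗-trans (additive mL f (q^ s · f)) (⊕-congˡ (shift-comm mL s f))

id-multiplier : Multiplier id
causal id-multiplier = id
additive id-multiplier f g = ≗-refl
shift-comm id-multiplier e f = ≗-refl

∘-multiplier : ∀ {L M} → Multiplier L → Multiplier M → Multiplier (L ∘ M)
causal (∘-multiplier mL mM) = causal mL ∘ causal mM
additive (∘-multiplier {M = M} mL mM) f g = ≗-trans (cong≗ mL (additive mM f g)) (additive mL (M f) (M g))
shift-comm (∘-multiplier {M = M} mL mM) e f = ≗-trans (cong≗ mL (shift-comm mM e f)) (shift-comm mL e (M f))

prod : (ℕ → Op) → ℕ → Op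
prod F zero    = id
prod F (suc k) = F k ∘ prod F k

prod-multiplier : ∀ {F} → (∀ k → Multiplier (F k)) → ∀ n → Multiplier (prod F n)
prod-multiplier mF zero    = id-multiplier
prod-multiplier mF (suc n) = ∘-multiplier (mF n) (prod-multiplier mF n)

prod-comm : ∀ {L F} → Multiplier L → (∀ k → Multiplier (F k)) → (∀ k f → L (F k f) ≗ F k (L f)) →
            ∀ n f → L (prod F n f) ≗ prod F n (L f)
prod-comm mL mF comm zero    f = ≗-refl
prod-comm mL mF comm (suc n) f = ≗-trans (comm n _) (cong≗ (mF n) (prod-comm mL mF comm n f))

prod-cancel : ∀ {F} → (∀ k {n f g} → F k f ≗[ n ] F k g → f ≗[ n ] g) →
              ∀ N {n f g} → prod F N f ≗[ n ] prod F N g → f ≗[ n ] g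
prod-cancel cancel zero    = id
prod-cancel cancel (suc N) = prod-cancel cancel N ∘ cancel N

geomProd : (ℕ → ℕ) → ℕ → Op
geomProd e = prod (λ k → geom (suc (e k)))

plusProd : (ℕ → ℕ) → ℕ → Op
plusProd e = prod (λ k → onePlus (suc (e k)))

geomProd-multiplier : ∀ e n → Multiplier (geomProd e n)
geomProd-multiplier e = prod-multiplier (geom-multiplier ∘ e)

plusProd-multiplier : ∀ e n → Multiplier (plusProd e n)
plusProd-multiplier e = prod-multiplier (onePlus-multiplier ∘ suc ∘ e)

geomProd-comm : ∀ {L} → Multiplier L → ∀ e n f → L (geomProd e n f) ≗ geomProd e n (L f)
geomProd-comm mL e = prod-comm mL (geom-multiplier ∘ e) (geom-comm mL ∘ e)

plusProd-comm : ∀ {L} → Multiplier L → ∀ e n f → L (plusProd e n f) ≗ plusProd e n (L f)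
plusProd-comm mL e = prod-comm mL (onePlus-multiplier ∘ suc ∘ e) (onePlus-comm mL ∘ suc ∘ e)

geomProd-cancel : ∀ e N {n f g} → geomProd e N f ≗[ n ] geomProd e N g → f ≗[ n ] g
geomProd-cancel e = prod-cancel (geom-cancel ∘ e)

-- Multiplication by 1/(q;q)_N, 1/(q;q²)_N, 1/(q²;q²)_N, (-q;q)_N and (-q;q²)_N respectively.
geomAll geomOdd geomEven plusAll plusOdd : ℕ → Op
geomAll  = geomProd id
geomOdd  = geomProd (2 *_)
geomEven = geomProd (suc ∘ (2 *_))
plusAll  = plusProd id
plusOdd  = plusProd (2 *_)

geomAll-trunc : ∀ {K} M f → K ≤ M → geomAll M f ≗[ K ] geomAll K f
geomAll-trunc zero    f z≤n   = λ _ _ → refl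
geomAll-trunc (suc M) f K≤1+M with m≤n⇒m<n∨m≡n K≤1+M
... | inj₁ (s≤s K≤M) = ≗[]-restrict K≤M (geom-trunc M (geomAll M f)) ⟨≗[]⟩ geomAll-trunc M f K≤M
... | inj₂ refl      = λ _ _ → refl

onePlus-geom : ∀ s f → onePlus (suc s) (geom (2 + 2 * s) f) ≗ geom (suc s) f
onePlus-geom s f = geom-unique s (begin
  g ⊕ q^ suc s · g                        ≈⟨ ⊕-congʳ (geom-rec (suc (2 * s)) f) ⟩
  (f ⊕ q^ 2 + 2 * s · g) ⊕ q^ suc s · g   ≈⟨ ⊕-swap-inner f (q^ 2 + 2 * s · g) (q^ suc s · g) ⟩
  f ⊕ (q^ suc s · g ⊕ q^ 2 + 2 * s · g)   ≡⟨ cong (λ e → f ⊕ (q^ suc s · g ⊕ q^ e · g)) (2+2s≡s+s s) ⟩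
  f ⊕ (q^ suc s · g ⊕ q^ suc s + suc s · g) ≈⟨ ⊕-congˡ (shift-distrib (suc s) (suc s) g g) ⟨
  f ⊕ q^ suc s · (g ⊕ q^ suc s · g)       ∎)
  where
  open ≗-Reasoning
  g = geom (2 + 2 * s) f
  2+2s≡s+s : ∀ s → 2 + 2 * s ≡ suc s + suc s
  2+2s≡s+s = solve-∀

plusAll-geomEven : ∀ N f → plusAll N (geomEven N f) ≗ geomAll N f
plusAll-geomEven zero    f = ≗-refl
plusAll-geomEven (suc N) f = begin
  onePlus (suc N) (plusAll N (geom (2 + 2 * N) (geomEven N f)))
    ≈⟨ cong≗ (onePlus-multiplier (suc N)) (geom-comm (plusProd-multiplier id N) (suc (2 * N)) (geomEven N f)) ⟩
  onePlus (suc N) (geom (2 + 2 * N) (plusAll N (geomEven N f)))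
    ≈⟨ cong≗ (onePlus-multiplier (suc N)) (cong≗ (geom-multiplier (suc (2 * N))) (plusAll-geomEven N f)) ⟩
  onePlus (suc N) (geom (2 + 2 * N) (geomAll N f))
    ≈⟨ onePlus-geom N (geomAll N f) ⟩
  geom (suc N) (geomAll N f) ∎
  where open ≗-Reasoning

2[1+k]≡2+2k : ∀ k → 2 * suc k ≡ 2 + 2 * k
2[1+k]≡2+2k = solve-∀

geomOdd-geomEven : ∀ k f → geomOdd k (geomEven k f) ≗ geomAll (2 * k) f
geomOdd-geomEven zero    f = ≗-refl
geomOdd-geomEven (suc k) f = begin
  geom (1 + 2 * k) (geomOdd k (geom (2 + 2 * k) (geomEven k f)))
    ≈⟨ cong≗ (geom-multiplier (2 * k)) (geomProd-comm (geom-multiplier (suc (2 * k))) (2 *_) k (geomEven k f)) ⟨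
  geom (1 + 2 * k) (geom (2 + 2 * k) (geomOdd k (geomEven k f)))
    ≈⟨ cong≗ (geom-multiplier (2 * k)) (cong≗ (geom-multiplier (suc (2 * k))) (geomOdd-geomEven k f)) ⟩
  geom (1 + 2 * k) (geom (2 + 2 * k) (geomAll (2 * k) f))
    ≈⟨ geom-comm (geom-multiplier (2 * k)) (suc (2 * k)) (geomAll (2 * k) f) ⟩
  geomAll (2 + 2 * k) f
    ≡⟨ cong (λ K → geomAll K f) (2[1+k]≡2+2k k) ⟨
  geomAll (2 * suc k) f ∎
  where open ≗-Reasoning

-- The theta series

tri-≥ : ∀ j → j ≤ tri j
tri-≥ zero    = z≤n
tri-≥ (suc j) = m≤n+m (suc j) (tri j)

shift-tri-below : ∀ f {m j} → m < j → (q^ tri j · f) m ≡ 0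
shift-tri-below f {j = j} m<j = shift-below f (<-≤-trans m<j (tri-≥ j))

thetaUpTo : ℕ → ℕ → Op
thetaUpTo t a f m = ∑[ j < suc a ] (q^ tri (t + j) · f) m

-- Multiplication by Σ_{k ≥ 0} q^{k(k+1)/2}: at degree m only the terms k ≤ m contribute.
theta : Op
theta f m = thetaUpTo 0 m f m

thetaUpTo-stable : ∀ {a m} f → m ≤ a → thetaUpTo 0 a f m ≡ theta f m
thetaUpTo-stable f m≤a = ∑-trunc _ (s≤s m≤a) (λ j m<j → shift-tri-below f m<j)

theta-multiplier : Multiplier theta
causal theta-multiplier f≗g m m≤n =
  ∑-cong (suc m) (λ j → shift-causal (tri j) f≗g m (m≤n⇒m≤o+n (tri j) m≤n))
additive theta-multiplier f g m =
  trans (∑-cong (suc m) (λ j → shift-⊕ (tri j) f g m))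
        (∑-+ (suc m) (λ j → (q^ tri j · f) m) (λ j → (q^ tri j · g) m))
shift-comm theta-multiplier e f m with split e m
... | below m<e =
  trans (∑-zeros (suc m) (λ j → trans (shift-swap (tri j) e f m) (shift-below (q^ tri j · f) m<e)))
        (sym (shift-below (theta f) m<e))
... | above r = begin
  ∑[ j < suc (e + r) ] (q^ tri j · q^ e · f) (e + r)
    ≡⟨ ∑-cong (suc (e + r)) (λ j → trans (shift-swap (tri j) e f (e + r)) (shift-above (q^ tri j · f) e r)) ⟩
  ∑[ j < suc (e + r) ] (q^ tri j · f) r
    ≡⟨ ∑-trunc _ (s≤s (m≤n+m r e)) (λ j r<j → shift-tri-below f r<j) ⟩
  theta f r
    ≡⟨ shift-above (theta f) e r ⟨
  (q^ e · theta f) (e + r) ∎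
  where open ≡-Reasoning

-- Gaussian binomials and the finite Jacobi triple product

-- gauss x y counts partitions into at most x parts, each at most y: it is the Gaussian binomial [x + y; x]_q.
gauss : ℕ → ℕ → Series
gauss zero    y       = δ₀
gauss (suc x) zero    = δ₀
gauss (suc x) (suc y) = gauss (suc x) y ⊕ q^ suc y · gauss x (suc y)

gauss-zeroʳ : ∀ x → gauss x 0 ≗ δ₀
gauss-zeroʳ zero    = ≗-refl
gauss-zeroʳ (suc x) = ≗-refl

gauss-pascal : ∀ x y → gauss (suc x) (suc y) ≗ gauss x (suc y) ⊕ q^ suc x · gauss (suc x) y
gauss-pascal zero    zero    = ≗-refl
gauss-pascal zero    (suc y) = begin
  gauss 1 (suc y) ⊕ q^ 2 + y · δ₀                ≈⟨ ⊕-congʳ (gauss-pascal zero y) ⟩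
  (δ₀ ⊕ q^ 1 · gauss 1 y) ⊕ q^ 2 + y · δ₀       ≈⟨ ⊕-assoc δ₀ (q^ 1 · gauss 1 y) (q^ 2 + y · δ₀) ⟩
  δ₀ ⊕ (q^ 1 · gauss 1 y ⊕ q^ 1 + suc y · δ₀)   ≈⟨ ⊕-congˡ (shift-distrib 1 (suc y) (gauss 1 y) δ₀) ⟨
  δ₀ ⊕ q^ 1 · gauss 1 (suc y)                   ∎
  where open ≗-Reasoning
gauss-pascal (suc x) zero    = begin
  δ₀ ⊕ q^ 1 · gauss (suc x) 1                   ≈⟨ ⊕-congˡ (shift-cong 1 (gauss-pascal x zero)) ⟩
  δ₀ ⊕ q^ 1 · (gauss x 1 ⊕ q^ suc x · δ₀)       ≈⟨ ⊕-congˡ (shift-distrib 1 (suc x) (gauss x 1) δ₀) ⟩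
  δ₀ ⊕ (q^ 1 · gauss x 1 ⊕ q^ 1 + suc x · δ₀)   ≈⟨ ⊕-assoc δ₀ (q^ 1 · gauss x 1) (q^ 2 + x · δ₀) ⟨
  gauss (suc x) 1 ⊕ q^ 2 + x · δ₀               ∎
  where open ≗-Reasoning
gauss-pascal (suc x) (suc y) = begin
  gauss (2 + x) (1 + y) ⊕ q^ 2 + y · gauss (1 + x) (2 + y)
    ≈⟨ ⊕-cong (gauss-pascal (suc x) y) (shift-cong (2 + y) (gauss-pascal x (suc y))) ⟩
  (P ⊕ q^ 2 + x · Q) ⊕ q^ 2 + y · (R ⊕ q^ 1 + x · P)
    ≈⟨ ⊕-congˡ (shift-distrib (2 + y) (1 + x) R P) ⟩
  (P ⊕ q^ 2 + x · Q) ⊕ (q^ 2 + y · R ⊕ q^ (2 + y) + (1 + x) · P)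
    ≡⟨ cong (λ e → (P ⊕ q^ 2 + x · Q) ⊕ (q^ 2 + y · R ⊕ q^ e · P)) (exponents x y) ⟩
  (P ⊕ q^ 2 + x · Q) ⊕ (q^ 2 + y · R ⊕ q^ (2 + x) + (1 + y) · P)
    ≈⟨ ⊕-interchange P (q^ 2 + x · Q) (q^ 2 + y · R) (q^ (2 + x) + (1 + y) · P) ⟩
  (P ⊕ q^ 2 + y · R) ⊕ (q^ 2 + x · Q ⊕ q^ (2 + x) + (1 + y) · P)
    ≈⟨ ⊕-congˡ (shift-distrib (2 + x) (1 + y) Q P) ⟨
  gauss (1 + x) (2 + y) ⊕ q^ 2 + x · gauss (2 + x) (1 + y) ∎
  where
  open ≗-Reasoning
  P = gauss (1 + x) (1 + y)
  Q = gauss (2 + x) y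
  R = gauss x (2 + y)
  exponents : ∀ x y → (2 + y) + (1 + x) ≡ (2 + x) + (1 + y)
  exponents = solve-∀

gauss-sym : ∀ x y → gauss x y ≗ gauss y x
gauss-sym zero    zero    = ≗-refl
gauss-sym zero    (suc y) = ≗-refl
gauss-sym (suc x) zero    = ≗-refl
gauss-sym (suc x) (suc y) =
  ≗-trans (⊕-cong (gauss-sym (suc x) y) (shift-cong (suc y) (gauss-sym x (suc y)))) (≗-sym (gauss-pascal y x))

gauss-approx : ∀ x y → gauss x y ≗[ x ] geomAll y δ₀
gauss-approx zero    y       = ≗[]-sym (geomAll-trunc y δ₀ z≤n)
gauss-approx (suc x) zero    = λ _ _ → refl
gauss-approx (suc x) (suc y) m m≤1+x = begin
  gauss (suc x) y m + (q^ suc y · gauss x (suc y)) m    ≡⟨ cong₂ _+_ (gauss-approx (suc x) y m m≤1+x)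
                                                              (shift-causal (suc y) (gauss-approx x (suc y)) m m≤1+y+x) ⟩
  geomAll y δ₀ m + (q^ suc y · geomAll (suc y) δ₀) m   ≡⟨ geom-rec y (geomAll y δ₀) m ⟨
  geomAll (suc y) δ₀ m                                 ∎
  where
  open ≡-Reasoning
  m≤1+y+x : m ≤ suc y + x
  m≤1+y+x = ≤-trans m≤1+x (s≤s (m≤n+m x y))

-- halfTheta a b t = Σ_{j ≤ a} q^{tri (t + j)} [a + b; a - j]_q
halfTheta : ℕ → ℕ → ℕ → Series
halfTheta zero    b t = q^ tri t · δ₀
halfTheta (suc a) b t = q^ tri t · gauss b (suc a) ⊕ halfTheta a (suc b) (suc t)

halfTheta-sucˡ : ∀ a b t → halfTheta (suc a) (suc b) t ≗
                 onePlus (t + suc a) (halfTheta a (suc b) t) ⊕ q^ tri t + suc a · gauss b (suc a)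
halfTheta-sucˡ zero b t = begin
  q^ tri t · (δ₀ ⊕ q^ 1 · gauss b 1) ⊕ q^ tri t + suc t · δ₀
    ≈⟨ ⊕-congʳ (shift-distrib (tri t) 1 δ₀ (gauss b 1)) ⟩
  (q^ tri t · δ₀ ⊕ q^ tri t + 1 · gauss b 1) ⊕ q^ tri t + suc t · δ₀
    ≈⟨ ⊕-swapʳ (q^ tri t · δ₀) (q^ tri t + 1 · gauss b 1) (q^ tri t + suc t · δ₀) ⟩
  (q^ tri t · δ₀ ⊕ q^ tri t + suc t · δ₀) ⊕ q^ tri t + 1 · gauss b 1
    ≡⟨ cong (λ e → (q^ tri t · δ₀ ⊕ q^ e · δ₀) ⊕ q^ tri t + 1 · gauss b 1) (exponent (tri t) t) ⟩
  (q^ tri t · δ₀ ⊕ q^ (t + 1) + tri t · δ₀) ⊕ q^ tri t + 1 · gauss b 1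
    ≈⟨ ⊕-congʳ {g = q^ tri t + 1 · gauss b 1} (⊕-congˡ {f = q^ tri t · δ₀} (shift-shift (t + 1) (tri t) δ₀)) ⟨
  onePlus (t + 1) (q^ tri t · δ₀) ⊕ q^ tri t + 1 · gauss b 1 ∎
  where
  open ≗-Reasoning
  exponent : ∀ T t → T + suc t ≡ (t + 1) + T
  exponent = solve-∀
halfTheta-sucˡ (suc a) b t = begin
  q^ tri t · (α ⊕ q^ 2 + a · β) ⊕ halfTheta (suc a) (2 + b) (suc t)
    ≈⟨ ⊕-cong (shift-distrib (tri t) (2 + a) α β) (halfTheta-sucˡ a (suc b) (suc t)) ⟩
  (q^ tri t · α ⊕ q^ tri t + (2 + a) · β) ⊕ ((ω ⊕ q^ suc t + suc a · ω) ⊕ q^ tri (suc t) + suc a · α)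
    ≡⟨ cong₂ (λ d e → (q^ tri t · α ⊕ q^ tri t + (2 + a) · β) ⊕ ((ω ⊕ q^ d · ω) ⊕ q^ e · α))
             (sym (+-suc t (suc a))) (exponent (tri t) t a) ⟩
  (q^ tri t · α ⊕ q^ tri t + (2 + a) · β) ⊕ ((ω ⊕ q^ t + (2 + a) · ω) ⊕ q^ (t + (2 + a)) + tri t · α)
    ≈⟨ rearrange (q^ tri t · α) (q^ tri t + (2 + a) · β) ω (q^ t + (2 + a) · ω) (q^ (t + (2 + a)) + tri t · α) ⟩
  ((q^ tri t · α ⊕ ω) ⊕ (q^ (t + (2 + a)) + tri t · α ⊕ q^ t + (2 + a) · ω)) ⊕ q^ tri t + (2 + a) · β
    ≈⟨ ⊕-congʳ {g = q^ tri t + (2 + a) · β} (⊕-congˡ {f = q^ tri t · α ⊕ ω}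
         (≗-trans (shift-⊕ (t + (2 + a)) (q^ tri t · α) ω) (⊕-congʳ (shift-shift (t + (2 + a)) (tri t) α)))) ⟨
  onePlus (t + (2 + a)) (halfTheta (suc a) (suc b) t) ⊕ q^ tri t + (2 + a) · β ∎
  where
  open ≗-Reasoning
  α = gauss (suc b) (suc a)
  β = gauss b (2 + a)
  ω = halfTheta a (2 + b) (suc t)
  exponent : ∀ T t a → (T + suc t) + suc a ≡ (t + (2 + a)) + T
  exponent = solve-∀
  rearrange : ∀ A B C D E → (A ⊕ B) ⊕ ((C ⊕ D) ⊕ E) ≗ ((A ⊕ C) ⊕ (E ⊕ D)) ⊕ B
  rearrange A B C D E m = lemma (A m) (B m) (C m) (D m) (E m)
    where
    lemma : ∀ a b c d e → (a + b) + ((c + d) + e) ≡ ((a + c) + (e + d)) + b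
    lemma = solve-∀

halfTheta-sucʳ : ∀ c e t → halfTheta c (suc (t + e)) t ⊕ q^ e · q^ tri t · gauss (t + e) c ≗
                 onePlus e (halfTheta c (t + e) t)
halfTheta-sucʳ zero    e t = ⊕-congˡ (shift-cong e (shift-cong (tri t) (gauss-zeroʳ (t + e))))
halfTheta-sucʳ (suc c) e t = begin
  (q^ tri t · gauss (suc b) (suc c) ⊕ halfTheta c (2 + b) (suc t)) ⊕ q^ e · q^ tri t · γ
    ≈⟨ ⊕-congʳ (⊕-congʳ (≗-trans (shift-cong (tri t) (gauss-pascal b c)) (shift-distrib (tri t) (suc b) γ δ))) ⟩
  ((q^ tri t · γ ⊕ q^ tri t + suc b · δ) ⊕ halfTheta c (2 + b) (suc t)) ⊕ q^ e · q^ tri t · γ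
    ≈⟨ ⊕-congʳ {g = q^ e · q^ tri t · γ} (⊕-congʳ {g = halfTheta c (2 + b) (suc t)}
         (⊕-congˡ {f = q^ tri t · γ} (≗-trans shifts (≗-sym (shift-shift e (tri (suc t)) δ))))) ⟩
  ((q^ tri t · γ ⊕ q^ e · q^ tri (suc t) · δ) ⊕ halfTheta c (2 + b) (suc t)) ⊕ q^ e · q^ tri t · γ
    ≈⟨ ⊕-congʳ (⊕-swap-inner (q^ tri t · γ) (q^ e · q^ tri (suc t) · δ) (halfTheta c (2 + b) (suc t))) ⟩
  (q^ tri t · γ ⊕ (halfTheta c (2 + b) (suc t) ⊕ q^ e · q^ tri (suc t) · δ)) ⊕ q^ e · q^ tri t · γ
    ≈⟨ ⊕-congʳ {g = q^ e · q^ tri t · γ} (⊕-congˡ {f = q^ tri t · γ} (halfTheta-sucʳ c e (suc t))) ⟩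
  (q^ tri t · γ ⊕ (ω ⊕ q^ e · ω)) ⊕ q^ e · q^ tri t · γ
    ≈⟨ rearrange (q^ tri t · γ) ω (q^ e · ω) (q^ e · q^ tri t · γ) ⟩
  (q^ tri t · γ ⊕ ω) ⊕ (q^ e · q^ tri t · γ ⊕ q^ e · ω)
    ≈⟨ ⊕-congˡ (shift-⊕ e (q^ tri t · γ) ω) ⟨
  onePlus e (halfTheta (suc c) b t) ∎
  where
  open ≗-Reasoning
  b = t + e
  γ = gauss b (suc c)
  δ = gauss (suc b) c
  ω = halfTheta c (suc b) (suc t)
  exponent : ∀ T t e → T + suc (t + e) ≡ e + (T + suc t)
  exponent = solve-∀
  shifts : q^ tri t + suc b · δ ≗ q^ e + tri (suc t) · δ
  shifts m = cong (λ k → (q^ k · δ) m) (exponent (tri t) t e)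
  rearrange : ∀ A B C D → (A ⊕ (B ⊕ C)) ⊕ D ≗ (A ⊕ B) ⊕ (D ⊕ C)
  rearrange A B C D m = lemma (A m) (B m) (C m) (D m)
    where
    lemma : ∀ a b c d → (a + (b + c)) + d ≡ (a + b) + (d + c)
    lemma = solve-∀

-- The finite Jacobi triple product (-zq;q)_a (-1/z;q)_{c+1} = Σ_{k=-c-1}^{a} z^k q^{k(k+1)/2} [a+c+1; a-k]_q
-- at z = 1, the terms k ≥ 0 and k = -1-j < 0 (where k(k+1)/2 = tri j) forming the two halfTheta's.
FiniteJacobi : ℕ → ℕ → Set
FiniteJacobi a c =
  plusAll a (plusAll c δ₀) ⊕ plusAll a (plusAll c δ₀) ≗ halfTheta a (suc c) 0 ⊕ halfTheta c (suc a) 0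

finiteJacobi-sym : ∀ a c → FiniteJacobi a c → FiniteJacobi c a
finiteJacobi-sym a c jacobi = begin
  plusAll c (plusAll a δ₀) ⊕ plusAll c (plusAll a δ₀) ≈⟨ ⊕-cong swap swap ⟨
  plusAll a (plusAll c δ₀) ⊕ plusAll a (plusAll c δ₀) ≈⟨ jacobi ⟩
  halfTheta a (suc c) 0 ⊕ halfTheta c (suc a) 0       ≈⟨ ⊕-comm (halfTheta a (suc c) 0) (halfTheta c (suc a) 0) ⟩
  halfTheta c (suc a) 0 ⊕ halfTheta a (suc c) 0       ∎
  where
  open ≗-Reasoning
  swap : plusAll a (plusAll c δ₀) ≗ plusAll c (plusAll a δ₀)
  swap = plusProd-comm (plusProd-multiplier id a) id c δ₀

-- Both sides are compared after adding q^{a+1} [a+c+1; c]_q, the term by which the two recurrences differ.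
finiteJacobi-suc : ∀ a c → FiniteJacobi a c → FiniteJacobi (suc a) c
finiteJacobi-suc a c jacobi m = +-cancelʳ-≡ (p m) _ _ (with-p m)
  where
  open ≗-Reasoning
  X = plusAll a (plusAll c δ₀)
  w₁ = halfTheta a (suc c) 0
  w₂ = halfTheta c (suc a) 0
  p = q^ suc a · gauss c (suc a)
  1+q = onePlus-multiplier (suc a)
  with-p : onePlus (suc a) X ⊕ onePlus (suc a) X ⊕ p ≗ halfTheta (suc a) (suc c) 0 ⊕ halfTheta c (2 + a) 0 ⊕ p
  with-p = begin
    (onePlus (suc a) X ⊕ onePlus (suc a) X) ⊕ p   ≈⟨ ⊕-congʳ (additive 1+q X X) ⟨
    onePlus (suc a) (X ⊕ X) ⊕ p                   ≈⟨ ⊕-congʳ (cong≗ 1+q jacobi) ⟩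
    onePlus (suc a) (w₁ ⊕ w₂) ⊕ p                 ≈⟨ ⊕-congʳ (additive 1+q w₁ w₂) ⟩
    (onePlus (suc a) w₁ ⊕ onePlus (suc a) w₂) ⊕ p ≈⟨ ⊕-swapʳ (onePlus (suc a) w₁) (onePlus (suc a) w₂) p ⟩
    (onePlus (suc a) w₁ ⊕ p) ⊕ onePlus (suc a) w₂
      ≈⟨ ⊕-cong (halfTheta-sucˡ a c 0) (halfTheta-sucʳ c (suc a) 0) ⟨
    v₁ ⊕ (v₂ ⊕ q^ suc a · gauss (suc a) c)        ≈⟨ ⊕-congˡ {f = v₁} (⊕-congˡ {f = v₂} p-sym) ⟩
    v₁ ⊕ (v₂ ⊕ p)                                 ≈⟨ ⊕-assoc v₁ v₂ p ⟨
    (v₁ ⊕ v₂) ⊕ p                                 ∎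
    where
    v₁ = halfTheta (suc a) (suc c) 0
    v₂ = halfTheta c (2 + a) 0
    p-sym : q^ suc a · gauss (suc a) c ≗ p
    p-sym = shift-cong (suc a) (gauss-sym (suc a) c)

finiteJacobi-zeroʳ : ∀ a → FiniteJacobi a 0
finiteJacobi-zeroʳ zero    = ≗-refl
finiteJacobi-zeroʳ (suc a) = finiteJacobi-suc a 0 (finiteJacobi-zeroʳ a)

finiteJacobi : ∀ a c → FiniteJacobi a c
finiteJacobi zero    c = finiteJacobi-sym c 0 (finiteJacobi-zeroʳ c)
finiteJacobi (suc a) c = finiteJacobi-suc a c (finiteJacobi a c)

-- Gauss's identity

halfTheta-approx : ∀ {N} a b t → a ≤ b → a ≤ N →
                   halfTheta a b t ≗[ tri t + a ] thetaUpTo t a (geomAll N δ₀)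
halfTheta-approx {N} zero b t _ _ m m≤T = begin
  (q^ tri t · δ₀) m           ≡⟨ shift-causal (tri t) (gauss-approx 0 N) m m≤T ⟩
  (q^ tri t · P) m            ≡⟨ cong (λ k → (q^ tri k · P) m) (+-identityʳ t) ⟨
  (q^ tri (t + 0) · P) m      ≡⟨ +-identityʳ _ ⟨
  thetaUpTo t 0 P m           ∎
  where
  open ≡-Reasoning
  P = geomAll N δ₀
halfTheta-approx {N} (suc a) b t 1+a≤b 1+a≤N m m≤T+1+a = begin
  (q^ tri t · gauss b (suc a)) m + halfTheta a (suc b) (suc t) m
    ≡⟨ cong₂ _+_ (shift-causal (tri t) gauss≗P m m≤T+1+a)
                 (halfTheta-approx a (suc b) (suc t) a≤1+b (≤-trans (n≤1+n a) 1+a≤N) m m≤T′+a) ⟩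
  (q^ tri t · P) m + thetaUpTo (suc t) a P m
    ≡⟨ cong₂ _+_ (cong (λ k → (q^ tri k · P) m) (+-identityʳ t))
                 (∑-cong (suc a) (λ j → cong (λ k → (q^ tri k · P) m) (+-suc t j))) ⟨
  thetaUpTo t (suc a) P m ∎
  where
  open ≡-Reasoning
  P = geomAll N δ₀
  gauss≗P : gauss b (suc a) ≗[ suc a ] P
  gauss≗P = ≗[]-restrict 1+a≤b (gauss-approx b (suc a)) ⟨≗[]⟩ ≗[]-sym (geomAll-trunc N δ₀ 1+a≤N)
  a≤1+b : a ≤ suc b
  a≤1+b = m≤n⇒m≤1+n (≤-trans (n≤1+n a) 1+a≤b)
  m≤T′+a : m ≤ tri (suc t) + a
  m≤T′+a = ≤-trans m≤T+1+a (≤-trans (+-monoʳ-≤ (tri t) (s≤s (m≤n+m a t)))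
                                     (≤-reflexive (sym (+-assoc (tri t) (suc t) a))))

double-injective : ∀ {x y} → x + x ≡ y + y → x ≡ y
double-injective {x} {y} x+x≡y+y = *-cancelˡ-≡ x y 2 (begin
  2 * x  ≡⟨ cong (x +_) (+-identityʳ x) ⟩
  x + x  ≡⟨ x+x≡y+y ⟩
  y + y  ≡⟨ cong (y +_) (+-identityʳ y) ⟨
  2 * y  ∎)
  where open ≡-Reasoning

jacobi-limit : ∀ N → plusAll N (plusAll N δ₀) ≗[ N ] theta (geomAll N δ₀)
jacobi-limit N m m≤N = begin
  plusAll N (plusAll N δ₀) m     ≡⟨ double-injective (finiteJacobi N N m) ⟩
  halfTheta N (suc N) 0 m        ≡⟨ halfTheta-approx N (suc N) 0 (n≤1+n N) ≤-refl m m≤N ⟩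
  thetaUpTo 0 N (geomAll N δ₀) m ≡⟨ thetaUpTo-stable (geomAll N δ₀) m≤N ⟩
  theta (geomAll N δ₀) m         ∎
  where open ≡-Reasoning

n≤2*n : ∀ n → n ≤ 2 * n
n≤2*n n = m≤n*m n 2

plusAll≗geomOdd : ∀ N → plusAll N δ₀ ≗[ N ] geomOdd N δ₀
plusAll≗geomOdd N = geomProd-cancel (suc ∘ (2 *_)) N (begin
  geomEven N (plusAll N δ₀)   ≈⟨ ≗⇒≗[] (geomProd-comm (plusProd-multiplier id N) (suc ∘ (2 *_)) N δ₀) ⟨
  plusAll N (geomEven N δ₀)   ≈⟨ ≗⇒≗[] (plusAll-geomEven N δ₀) ⟩
  geomAll N δ₀                ≈⟨ geomAll-trunc (2 * N) δ₀ (n≤2*n N) ⟨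
  geomAll (2 * N) δ₀          ≈⟨ ≗⇒≗[] (geomOdd-geomEven N δ₀) ⟨
  geomOdd N (geomEven N δ₀)   ≈⟨ ≗⇒≗[] (geomProd-comm (geomProd-multiplier (suc ∘ (2 *_)) N) (2 *_) N δ₀) ⟨
  geomEven N (geomOdd N δ₀)   ∎)
  where open ≗[]-Reasoning N

gauss-identity : ∀ N → geomOdd N δ₀ ≗[ N ] theta (geomEven N δ₀)
gauss-identity N = geomProd-cancel (2 *_) N (begin
  geomOdd N (geomOdd N δ₀)           ≈⟨ causal (geomProd-multiplier (2 *_) N) (plusAll≗geomOdd N) ⟨
  geomOdd N (plusAll N δ₀)           ≈⟨ ≗⇒≗[] (plusProd-comm (geomProd-multiplier (2 *_) N) id N δ₀) ⟩
  plusAll N (geomOdd N δ₀)           ≈⟨ causal (plusProd-multiplier id N) (plusAll≗geomOdd N) ⟨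
  plusAll N (plusAll N δ₀)           ≈⟨ jacobi-limit N ⟩
  theta (geomAll N δ₀)               ≈⟨ causal theta-multiplier (geomAll-trunc (2 * N) δ₀ (n≤2*n N)) ⟨
  theta (geomAll (2 * N) δ₀)         ≈⟨ ≗⇒≗[] (cong≗ theta-multiplier (geomOdd-geomEven N δ₀)) ⟨
  theta (geomOdd N (geomEven N δ₀))  ≈⟨ ≗⇒≗[] (geomProd-comm theta-multiplier (2 *_) N (geomEven N δ₀)) ⟩
  geomOdd N (theta (geomEven N δ₀))  ∎)
  where open ≗[]-Reasoning N

-- Overpartitions into odd parts and pod

-- 1 + 2 Σ_{m ≥ 1} q^{ms} = (1 + q^s) / (1 - q^s)
ovOdd-suc : ∀ k → ovOdd (suc k) ≗ onePlus (suc (2 * k)) (geom (suc (2 * k)) (ovOdd k))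
ovOdd-suc k n = begin
  ovOdd k n + 2 * S                                ≡⟨ cong (λ x → ovOdd k n + (S + x)) (+-identityʳ S) ⟩
  ovOdd k n + (S + S)                              ≡⟨ +-assoc (ovOdd k n) S S ⟨
  geom s (ovOdd k) n + S                           ≡⟨ cong (geom s (ovOdd k) n +_) (sumMult≥1-rec (2 * k) (ovOdd k) n) ⟩
  geom s (ovOdd k) n + (q^ s · geom s (ovOdd k)) n ∎
  where
  open ≡-Reasoning
  s = suc (2 * k)
  S = sumMult≥1 s n (ovOdd k)

ovOdd-factorisation : ∀ k → ovOdd k ≗ plusOdd k (geomOdd k δ₀)
ovOdd-factorisation zero    = ≗-refl
ovOdd-factorisation (suc k) = begin
  ovOdd (suc k)                                 ≈⟨ ovOdd-suc k ⟩
  onePlus s (geom s (ovOdd k))                  ≈⟨ cong≗ 1+qˢ (cong≗ G (ovOdd-factorisation k)) ⟩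
  onePlus s (geom s (plusOdd k (geomOdd k δ₀))) ≈⟨ cong≗ 1+qˢ (plusProd-comm G (2 *_) k (geomOdd k δ₀)) ⟩
  plusOdd (suc k) (geomOdd (suc k) δ₀)          ∎
  where
  open ≗-Reasoning
  s = suc (2 * k)
  1+qˢ = onePlus-multiplier s
  G = geom-multiplier (2 * k)

podB-odd : ∀ j → isOdd (suc j) ≡ true → podB (suc j) ≗ onePlus (suc j) (podB j)
podB-odd j odd n rewrite odd = refl

podB-even : ∀ j → isOdd (suc j) ≡ false → podB (suc j) ≗ geom (suc j) (podB j)
podB-even j even n rewrite even = refl

isOdd-2k : ∀ k → isOdd (2 * k) ≡ false
isOdd-2k zero    = refl
isOdd-2k (suc k) = trans (cong isOdd (2[1+k]≡2+2k k)) (isOdd-2k k)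

isOdd-1+2k : ∀ k → isOdd (suc (2 * k)) ≡ true
isOdd-1+2k zero    = refl
isOdd-1+2k (suc k) = trans (cong (isOdd ∘ suc) (2[1+k]≡2+2k k)) (isOdd-1+2k k)

podB-2k-factorisation : ∀ k → podB (2 * k) ≗ plusOdd k (geomEven k δ₀)
podB-2k-factorisation zero    = ≗-refl
podB-2k-factorisation (suc k) = begin
  podB (2 * suc k)                                      ≡⟨ cong podB (2[1+k]≡2+2k k) ⟩
  podB (2 + 2 * k)                                      ≈⟨ podB-even (suc (2 * k)) (isOdd-2k k) ⟩
  geom (2 + 2 * k) (podB (1 + 2 * k))                   ≈⟨ cong≗ G (podB-odd (2 * k) (isOdd-1+2k k)) ⟩
  geom (2 + 2 * k) (onePlus (1 + 2 * k) (podB (2 * k))) ≈⟨ cong≗ G (cong≗ 1+qˢ (podB-2k-factorisation k)) ⟩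
  geom (2 + 2 * k) (plusOdd (suc k) (geomEven k δ₀))    ≈⟨ plusProd-comm G (2 *_) (suc k) (geomEven k δ₀) ⟩
  plusOdd (suc k) (geomEven (suc k) δ₀)                 ∎
  where
  open ≗-Reasoning
  G = geom-multiplier (suc (2 * k))
  1+qˢ = onePlus-multiplier (suc (2 * k))

podB-trunc : ∀ K → podB (suc K) ≗[ K ] podB K
podB-trunc K m m≤K with isOdd (suc K)
... | true  = onePlus-trunc K (podB K) m m≤K
... | false = geom-trunc K (podB K) m m≤K

podB-stable : ∀ {m} K → m ≤ K → podB K m ≡ pod m
podB-stable zero    z≤n   = refl
podB-stable (suc K) m≤1+K with m≤n⇒m<n∨m≡n m≤1+K
... | inj₁ (s≤s m≤K) = trans (podB-trunc K _ m≤K) (podB-stable K m≤K)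
... | inj₂ refl      = refl

theorem3p1 : (n : ℕ) → pbarO n ≡ podTriSum n
theorem3p1 n = begin
  pbarO n                              ≡⟨ ovOdd-factorisation n n ⟩
  plusOdd n (geomOdd n δ₀) n           ≡⟨ causal (plusProd-multiplier (2 *_) n) (gauss-identity n) n ≤-refl ⟩
  plusOdd n (theta (geomEven n δ₀)) n  ≡⟨ plusProd-comm theta-multiplier (2 *_) n (geomEven n δ₀) n ⟨
  theta (plusOdd n (geomEven n δ₀)) n  ≡⟨ cong≗ theta-multiplier (podB-2k-factorisation n) n ⟨
  theta (podB (2 * n)) n               ≡⟨ causal theta-multiplier podB-2n≗pod n ≤-refl ⟩
  theta pod n                          ≡⟨ cong sum (map-upTo _ (suc n)) ⟨
  podTriSum n                          ∎
  where
  open ≡-Reasoning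
  podB-2n≗pod : podB (2 * n) ≗[ n ] pod
  podB-2n≗pod m m≤n = podB-stable (2 * n) (≤-trans m≤n (n≤2*n n))
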